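{- Let $p$ be a prime and let $A,B$ be non-empty subsets of the field $\mathbb{F}_p$, with sumset $A+B=\{a+b: a\in A, b\in B\}$. Then either \[\lambda(A+B)\geq\min\{\lambda(A),\lambda(B)\},\] or \[|A+B|\geq |A|+|B|+\lambda(A+B).\]
   Context: For a finite non-empty subset $A$ of a field $F$, its characteristic polynomial is $\Pi_A(X)=\prod_{a\in A}(X-a)$. For $\lambda\in\{0,\dots,|A|\}$, $A$ is called $\lambda$-null if in $\Pi_A(X)$ the coefficients of $X^{|A|-1},\dots,X^{|A|-\lambda}$ all vanish. Define $\lambda(A)=\max\{\lambda\in\{0,\dots,|A|\}: A\text{ is }\lambda\text{ -null}\}$. -}

module Defs where

open import Data.Nat using (ℕ; zero; suc; _≤_; NonZero)
open import Data.Nat.DivMod using (_mod_)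
open import Data.Nat.Primality using (Prime; prime⇒nonZero)
open import Data.Integer as ℤ using (ℤ; +_; _-_; _*_)
open import Data.Integer.Divisibility using () renaming (_∣_ to _∣ℤ_)
open import Data.Fin using (Fin; toℕ)
open import Data.Fin.Subset using (Subset; _∈_; ∣_∣)
open import Data.List using (List; []; _∷_; foldr)
open import Data.Vec using (Vec; []; _∷_)
open import Data.Bool using (true; false)
open import Data.Product using (∃; ∃₂; _×_; _,_)
open import Relation.Binary.PropositionalEquality using (_≡_)

-- The field 𝔽_p is modelled as Fin p (residues 0,…,p-1), with addition mod p.
_⊕[_]_ : ∀ {p} → Fin p → Prime p → Fin p → Fin p
_⊕[_]_ {p} a pr b = let instance nz = prime⇒nonZero pr in (toℕ a Data.Nat.+ toℕ b) mod p

elems : ∀ {n} → Subset n → List (Fin n)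
elems []            = []
elems (true  ∷ s)   = Data.Fin.zero ∷ Data.List.map Data.Fin.suc (elems s)
elems (false ∷ s)   = Data.List.map Data.Fin.suc (elems s)

-- Polynomials are coefficient lists in DESCENDING order of degree:
-- [c₀, c₁, …, c_d] represents c₀ X^d + c₁ X^(d-1) + … + c_d.
-- Multiplication of such a polynomial by (X - a):
mulXminus : ℤ → List ℤ → List ℤ
mulXminus a cs = go (+ 0) cs
  where
  go : ℤ → List ℤ → List ℤ
  go prev []       = (+ 0 - a * prev) ∷ []
  go prev (d ∷ ds) = (d - a * prev) ∷ go d ds

-- Characteristic polynomial Π_A(X) = ∏_{a∈A} (X - a), computed with integer
-- lifts of the elements; its image in 𝔽_p[X] is obtained by reducing
-- coefficients mod p (reduction ℤ → 𝔽_p is a ring homomorphism).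
charPoly : ∀ {p} → Subset p → List ℤ
charPoly A = foldr (λ a P → mulXminus (+ toℕ a) P) (+ 1 ∷ []) (elems A)

-- k-th entry of a descending coefficient list (= coefficient of X^(|A|-k));
-- 0 outside the range.
coeff : List ℤ → ℕ → ℤ
coeff []       _       = + 0
coeff (c ∷ cs) zero    = c
coeff (c ∷ cs) (suc k) = coeff cs k

-- A is λ-null: λ ≤ |A| and the coefficients of X^(|A|-1), …, X^(|A|-λ)
-- of Π_A vanish in 𝔽_p (i.e. are divisible by p as integers).
IsNull : ∀ {p} → Subset p → ℕ → Set
IsNull {p} A l = l ≤ ∣ A ∣ × (∀ k → 1 ≤ k → k ≤ l → (+ p) ∣ℤ coeff (charPoly A) k)

-- λ(A) = max{λ ∈ {0,…,|A|} : A is λ-null}, as the graph of this function.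
IsLambda : ∀ {p} → Subset p → ℕ → Set
IsLambda A l = IsNull A l × (∀ m → IsNull A m → m ≤ l)

IsSumset : ∀ {p} → Prime p → Subset p → Subset p → Subset p → Set
IsSumset pr A B S = ∀ c → (c ∈ S → ∃₂ λ a b → a ∈ A × b ∈ B × c ≡ a ⊕[ pr ] b)
                        × (∃₂ (λ a b → a ∈ A × b ∈ B × c ≡ a ⊕[ pr ] b) → c ∈ S)

module Submission where

-- For nodes a₀, …, a_α in 𝔽_p the divided-difference functional g ↦ g[a₀, …, a_α] kills every
-- polynomial vanishing at the nodes and sends Xⁱ to h_{i-α}(a₀, …, a_α); applied to Xᵏ Π_A it shows
-- that these values also vanish for α < i ≤ α + m when A is m-null. If P vanishes on A + B, the
-- product of the functionals of A and B kills Xᵘ Yᵛ P(X + Y). Let A and B be m-null and write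
-- deg P = N + m, with the coefficient of X^N in P nonzero. If N ≤ α + β, offsets u, v with
-- u + v + N = α + β leave a single surviving term, (N choose α - u) times that coefficient, which is
-- nonzero because N < p. Hence |A| + |B| ≤ N + 1. For P = Π_{A+B} and m = λ(A+B) + 1 this is the
-- second alternative; the case λ(A+B) = |A+B| is excluded in the same way by P = (X - 1) Π_{A+B}
-- and m = 1.

open import Data.Bool using (true; false)
open import Data.Empty using (⊥-elim)
open import Data.Fin as Fin using (Fin; toℕ)
import Data.Fin.Properties as Fin
open import Data.Fin.Subset using (Subset; Nonempty; ∣_∣) renaming (_∈_ to _∈ₛ_)
open import Data.Fin.Subset.Properties using (∣p∣≤n)
open import Data.Integer as ℤ using (ℤ; +_; 0ℤ; 1ℤ; _+_; _-_; _*_; _^_; _⊖_)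
open import Data.Integer.Divisibility using () renaming (_∣_ to _∣ᵤ_)
open import Data.Integer.Divisibility.Signed
  using (_∣_; divides; ∣ᵤ⇒∣; ∣⇒∣ᵤ; ∣m∣n⇒∣m+n; ∣m+n∣m⇒∣n; ∣m+n∣n⇒∣m; ∣m⇒∣m*n; ∣n⇒∣m*n; ∣m⇒∣-m)
import Data.Integer.Properties as ℤ
open import Data.Integer.Tactic.RingSolver using (solve-∀)
open import Data.List using (List; []; _∷_; length; map; foldr; replicate; reverse; drop; _++_; _∷ʳ_)
open import Data.List.Membership.Propositional using (_∈_)
open import Data.List.Membership.Propositional.Properties using (∈-map⁺; ∈-map⁻)
open import Data.List.Properties using (unfold-reverse; length-reverse; length-map; foldr-map)
import Data.List.Relation.Unary.All as All
import Data.List.Relation.Unary.All.Properties as All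
open import Data.List.Relation.Unary.AllPairs as AllPairs using (AllPairs; []; _∷_)
import Data.List.Relation.Unary.AllPairs.Properties as AllPairs
open import Data.List.Relation.Unary.Any using (here; there)
open import Data.List.Relation.Unary.Unique.Propositional using (Unique)
import Data.List.Relation.Unary.Unique.Propositional.Properties as Unique
open import Data.Nat as ℕ using (ℕ; zero; suc; _≤_; _<_; _∸_; _⊓_; _!; z≤n; s≤s)
open import Data.Nat.Combinatorics using (_C_; nCn≡1; nCk+nC[k+1]≡[n+1]C[k+1]; k![n∸k]!∣n!)
open import Data.Nat.Combinatorics.Specification using (nCk≡n!/k![n-k]!)
import Data.Nat.Divisibility as ℕ
open import Data.Nat.DivMod using (_/_; _%_; m/n*n≡m; m≡m%n+[m/n]*n; m%n<n)
open import Data.Nat.Primality using (Prime; euclidsLemma; ¬prime[1]; prime⇒nonZero)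
import Data.Nat.Properties as ℕ
open import Data.Nat.Properties using (_!*_!≢0)
open import Algebra.Properties.CommutativeSemigroup ℕ.+-commutativeSemigroup using (xy∙z≈xz∙y; interchange)
open import Data.Product using (∃₂; _×_; _,_; proj₁; proj₂)
open import Data.Sum as Sum using (_⊎_; inj₁; inj₂)
open import Data.Vec using ([]; _∷_; here; there)
open import Function using (_∘_)
open import Relation.Binary.PropositionalEquality
open import Relation.Nullary using (¬_; yes; no)
open ≡-Reasoning

open import Defs

-- Polynomials over ℤ

-- Ascending coefficient lists: [c₀, c₁, …] is c₀ + c₁ X + ⋯ (Defs uses the descending order).
eval : List ℤ → ℤ → ℤ
eval []       z = 0ℤ
eval (c ∷ cs) z = c + z * eval cs z

pairing : (ℕ → ℤ) → List ℤ → ℤ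
pairing T []       = 0ℤ
pairing T (c ∷ cs) = c * T 0 + pairing (T ∘ suc) cs

pairing-*ˡ : ∀ c T g → pairing (λ i → c * T i) g ≡ c * pairing T g
pairing-*ˡ c T []       = sym (ℤ.*-zeroʳ c)
pairing-*ˡ c T (d ∷ ds) = begin
  d * (c * T 0) + pairing (λ i → c * T (suc i)) ds ≡⟨ cong (_+_ (d * (c * T 0))) (pairing-*ˡ c (T ∘ suc) ds) ⟩
  d * (c * T 0) + c * pairing (T ∘ suc) ds         ≡⟨ rearrange d c (T 0) _ ⟩
  c * (d * T 0 + pairing (T ∘ suc) ds)             ∎
  where
  rearrange : ∀ d c t e → d * (c * t) + c * e ≡ c * (d * t + e)
  rearrange = solve-∀

pairing-powers : ∀ z g → pairing (z ^_) g ≡ eval g z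
pairing-powers z []       = refl
pairing-powers z (c ∷ cs) = cong₂ _+_ (ℤ.*-identityʳ c)
  (trans (pairing-*ˡ z (z ^_) cs) (cong (z *_) (pairing-powers z cs)))

quotient : List ℤ → ℤ → List ℤ
quotient []       a = []
quotient (c ∷ cs) a = eval cs a ∷ quotient cs a

eval-quotient : ∀ g a z → (z - a) * eval (quotient g a) z + eval g a ≡ eval g z
eval-quotient []       a z = trans (ℤ.+-identityʳ _) (ℤ.*-zeroʳ (z - a))
eval-quotient (c ∷ cs) a z = begin
  (z - a) * (eval cs a + z * eval (quotient cs a) z) + (c + a * eval cs a) ≡⟨ rearrange z a (eval cs a) _ c ⟩
  c + z * ((z - a) * eval (quotient cs a) z + eval cs a)                   ≡⟨ cong (λ w → c + z * w) (eval-quotient cs a z) ⟩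
  c + z * eval cs z                                                        ∎
  where
  rearrange : ∀ z a e q c → (z - a) * (e + z * q) + (c + a * e) ≡ c + z * ((z - a) * q + e)
  rearrange = solve-∀

pairing-quotient : ∀ a (T U : ℕ → ℤ) → (∀ i → T (suc i) ≡ a * T i + U i) →
                   ∀ g → pairing T g ≡ eval g a * T 0 + pairing U (quotient g a)
pairing-quotient a T U rec []       = sym (ℤ.+-identityʳ (0ℤ * T 0))
pairing-quotient a T U rec (c ∷ cs) = begin
  c * T 0 + pairing (T ∘ suc) cs
    ≡⟨ cong (_+_ (c * T 0)) (pairing-quotient a (T ∘ suc) (U ∘ suc) (rec ∘ suc) cs) ⟩
  c * T 0 + (eval cs a * T 1 + pairing (U ∘ suc) (quotient cs a))
    ≡⟨ cong (λ t → c * T 0 + (eval cs a * t + pairing (U ∘ suc) (quotient cs a))) (rec 0) ⟩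
  c * T 0 + (eval cs a * (a * T 0 + U 0) + pairing (U ∘ suc) (quotient cs a))
    ≡⟨ rearrange c (eval cs a) a (T 0) (U 0) _ ⟩
  (c + a * eval cs a) * T 0 + (eval cs a * U 0 + pairing (U ∘ suc) (quotient cs a))
    ∎
  where
  rearrange : ∀ c e a t u r → c * t + (e * (a * t + u) + r) ≡ (c + a * e) * t + (e * u + r)
  rearrange = solve-∀

pairing-+seq : ∀ T U g → pairing (λ i → T i + U i) g ≡ pairing T g + pairing U g
pairing-+seq T U []       = refl
pairing-+seq T U (c ∷ cs) =
  trans (cong (_+_ (c * (T 0 + U 0))) (pairing-+seq (T ∘ suc) (U ∘ suc) cs)) (rearrange c (T 0) (U 0) _ _)
  where
  rearrange : ∀ c t u e f → c * (t + u) + (e + f) ≡ c * t + e + (c * u + f)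
  rearrange = solve-∀

infixl 6 _+ₚ_
_+ₚ_ : List ℤ → List ℤ → List ℤ
[]       +ₚ ys       = ys
(x ∷ xs) +ₚ []       = x ∷ xs
(x ∷ xs) +ₚ (y ∷ ys) = x + y ∷ xs +ₚ ys

scaleₚ : ℤ → List ℤ → List ℤ
scaleₚ c = map (c *_)

pad : ℕ → List ℤ → List ℤ
pad k g = replicate k 0ℤ ++ g

eval-+ₚ : ∀ xs ys z → eval (xs +ₚ ys) z ≡ eval xs z + eval ys z
eval-+ₚ []       ys       z = sym (ℤ.+-identityˡ _)
eval-+ₚ (x ∷ xs) []       z = sym (ℤ.+-identityʳ _)
eval-+ₚ (x ∷ xs) (y ∷ ys) z = trans (cong (λ w → x + y + z * w) (eval-+ₚ xs ys z)) (rearrange x y z _ _)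
  where
  rearrange : ∀ x y z e f → x + y + z * (e + f) ≡ x + z * e + (y + z * f)
  rearrange = solve-∀

pairing-+ₚ : ∀ T xs ys → pairing T (xs +ₚ ys) ≡ pairing T xs + pairing T ys
pairing-+ₚ T []       ys       = sym (ℤ.+-identityˡ _)
pairing-+ₚ T (x ∷ xs) []       = sym (ℤ.+-identityʳ _)
pairing-+ₚ T (x ∷ xs) (y ∷ ys) =
  trans (cong (_+_ ((x + y) * T 0)) (pairing-+ₚ (T ∘ suc) xs ys)) (rearrange x y (T 0) _ _)
  where
  rearrange : ∀ x y t e f → (x + y) * t + (e + f) ≡ x * t + e + (y * t + f)
  rearrange = solve-∀

eval-scaleₚ : ∀ c xs z → eval (scaleₚ c xs) z ≡ c * eval xs z
eval-scaleₚ c []       z = sym (ℤ.*-zeroʳ c)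
eval-scaleₚ c (x ∷ xs) z = trans (cong (λ w → c * x + z * w) (eval-scaleₚ c xs z)) (rearrange c x z _)
  where
  rearrange : ∀ c x z e → c * x + z * (c * e) ≡ c * (x + z * e)
  rearrange = solve-∀

pairing-scaleₚ : ∀ T c xs → pairing T (scaleₚ c xs) ≡ c * pairing T xs
pairing-scaleₚ T c []       = sym (ℤ.*-zeroʳ c)
pairing-scaleₚ T c (x ∷ xs) =
  trans (cong (_+_ (c * x * T 0)) (pairing-scaleₚ (T ∘ suc) c xs)) (rearrange c x (T 0) _)
  where
  rearrange : ∀ c x t e → c * x * t + c * e ≡ c * (x * t + e)
  rearrange = solve-∀

eval-pad : ∀ k g z → eval (pad k g) z ≡ z ^ k * eval g z
eval-pad zero    g z = sym (ℤ.*-identityˡ _)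
eval-pad (suc k) g z = begin
  0ℤ + z * eval (pad k g) z ≡⟨ ℤ.+-identityˡ _ ⟩
  z * eval (pad k g) z      ≡⟨ cong (z *_) (eval-pad k g z) ⟩
  z * (z ^ k * eval g z)    ≡⟨ ℤ.*-assoc z (z ^ k) _ ⟨
  z * z ^ k * eval g z      ∎

pairing-pad : ∀ k T g → pairing T (pad k g) ≡ pairing (T ∘ (k ℕ.+_)) g
pairing-pad zero    T g = refl
pairing-pad (suc k) T g = trans (ℤ.+-identityˡ _) (pairing-pad k (T ∘ suc) g)

pairing-∷ʳ : ∀ T xs c → pairing T (xs ∷ʳ c) ≡ pairing T xs + c * T (length xs)
pairing-∷ʳ T []       c = trans (ℤ.+-identityʳ (c * T 0)) (sym (ℤ.+-identityˡ (c * T 0)))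
pairing-∷ʳ T (x ∷ xs) c =
  trans (cong (_+_ (x * T 0)) (pairing-∷ʳ (T ∘ suc) xs c)) (sym (ℤ.+-assoc (x * T 0) _ _))

pairingDesc : (ℕ → ℤ) → List ℤ → ℤ
pairingDesc T []       = 0ℤ
pairingDesc T (c ∷ cs) = c * T (length cs) + pairingDesc T cs

evalDesc : List ℤ → ℤ → ℤ
evalDesc P z = pairingDesc (z ^_) P

pairing-reverse : ∀ T P → pairing T (reverse P) ≡ pairingDesc T P
pairing-reverse T []       = refl
pairing-reverse T (c ∷ cs) = begin
  pairing T (reverse (c ∷ cs))
    ≡⟨ cong (pairing T) (unfold-reverse c cs) ⟩
  pairing T (reverse cs ∷ʳ c)
    ≡⟨ pairing-∷ʳ T (reverse cs) c ⟩
  pairing T (reverse cs) + c * T (length (reverse cs))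
    ≡⟨ cong₂ (λ e n → e + c * T n) (pairing-reverse T cs) (length-reverse cs) ⟩
  pairingDesc T cs + c * T (length cs)
    ≡⟨ ℤ.+-comm (pairingDesc T cs) _ ⟩
  c * T (length cs) + pairingDesc T cs
    ∎

eval-reverse : ∀ P z → eval (reverse P) z ≡ evalDesc P z
eval-reverse P z = trans (sym (pairing-powers z (reverse P))) (pairing-reverse (z ^_) P)

coeff-≥length : ∀ Q i → length Q ≤ i → coeff Q i ≡ 0ℤ
coeff-≥length []       i       _         = refl
coeff-≥length (c ∷ cs) (suc i) (s≤s len≤) = coeff-≥length cs i len≤

-- The recursion of Defs.mulXminus after its first output coefficient (its helper `go` is local).
mulXminusTail : ℤ → ℤ → List ℤ → List ℤ
mulXminusTail a d ds = drop 1 (mulXminus a (d ∷ ds))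

length-mulXminusTail : ∀ a d ds → length (mulXminusTail a d ds) ≡ suc (length ds)
length-mulXminusTail a d []       = refl
length-mulXminusTail a d (e ∷ es) = cong suc (length-mulXminusTail a e es)

length-mulXminus : ∀ a Q → length (mulXminus a Q) ≡ suc (length Q)
length-mulXminus a []       = refl
length-mulXminus a (d ∷ ds) = cong suc (length-mulXminusTail a d ds)

evalDesc-mulXminusTail : ∀ a d ds z →
  evalDesc (mulXminusTail a d ds) z ≡ (z - a) * evalDesc ds z - a * d * z ^ length ds
evalDesc-mulXminusTail a d []       z = rearrange a d z
  where
  rearrange : ∀ a d z → (0ℤ - a * d) * 1ℤ + 0ℤ ≡ (z - a) * 0ℤ - a * d * 1ℤ
  rearrange = solve-∀
evalDesc-mulXminusTail a d (e ∷ es) z = begin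
  (e - a * d) * z ^ length (mulXminusTail a e es) + evalDesc (mulXminusTail a e es) z
    ≡⟨ cong₂ (λ n w → (e - a * d) * z ^ n + w) (length-mulXminusTail a e es) (evalDesc-mulXminusTail a e es z) ⟩
  (e - a * d) * (z * z ^ length es) + ((z - a) * evalDesc es z - a * e * z ^ length es)
    ≡⟨ rearrange a d e z (z ^ length es) (evalDesc es z) ⟩
  (z - a) * (e * z ^ length es + evalDesc es z) - a * d * (z * z ^ length es)
    ∎
  where
  rearrange : ∀ a d e z P E → (e - a * d) * (z * P) + ((z - a) * E - a * e * P)
                            ≡ (z - a) * (e * P + E) - a * d * (z * P)
  rearrange = solve-∀

evalDesc-mulXminus : ∀ a Q z → evalDesc (mulXminus a Q) z ≡ (z - a) * evalDesc Q z
evalDesc-mulXminus a []       z = rearrange a z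
  where
  rearrange : ∀ a z → (0ℤ - a * 0ℤ) * 1ℤ + 0ℤ ≡ (z - a) * 0ℤ
  rearrange = solve-∀
evalDesc-mulXminus a (d ∷ ds) z = begin
  (d - a * 0ℤ) * z ^ length (mulXminusTail a d ds) + evalDesc (mulXminusTail a d ds) z
    ≡⟨ cong₂ (λ n w → (d - a * 0ℤ) * z ^ n + w) (length-mulXminusTail a d ds) (evalDesc-mulXminusTail a d ds z) ⟩
  (d - a * 0ℤ) * (z * z ^ length ds) + ((z - a) * evalDesc ds z - a * d * z ^ length ds)
    ≡⟨ rearrange a d z _ _ ⟩
  (z - a) * (d * z ^ length ds + evalDesc ds z)
    ∎
  where
  rearrange : ∀ a d z P E → (d - a * 0ℤ) * (z * P) + ((z - a) * E - a * d * P) ≡ (z - a) * (d * P + E)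
  rearrange = solve-∀

coeff₀-mulXminus : ∀ a Q → coeff Q 0 ≡ 1ℤ → coeff (mulXminus a Q) 0 ≡ 1ℤ
coeff₀-mulXminus a (d ∷ ds) refl = cong (λ x → 1ℤ - x) (ℤ.*-zeroʳ a)

coeff₁-mulXminus : ∀ a Q → coeff (mulXminus a Q) 1 ≡ coeff Q 1 - a * coeff Q 0
coeff₁-mulXminus a []           = sym (cong (λ x → 0ℤ - x) (ℤ.*-zeroʳ a))
coeff₁-mulXminus a (d ∷ [])     = refl
coeff₁-mulXminus a (d ∷ e ∷ es) = refl

charPolyList : List ℤ → List ℤ
charPolyList = foldr mulXminus (1ℤ ∷ [])

length-charPolyList : ∀ As → length (charPolyList As) ≡ suc (length As)
length-charPolyList []       = refl
length-charPolyList (a ∷ As) = trans (length-mulXminus a (charPolyList As)) (cong suc (length-charPolyList As))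

charPolyList-monic : ∀ As → coeff (charPolyList As) 0 ≡ 1ℤ
charPolyList-monic []       = refl
charPolyList-monic (a ∷ As) = coeff₀-mulXminus a (charPolyList As) (charPolyList-monic As)

evalDesc-charPolyList-root : ∀ {As w} → w ∈ As → evalDesc (charPolyList As) w ≡ 0ℤ
evalDesc-charPolyList-root {a ∷ As} {w} (here refl) = begin
  evalDesc (mulXminus w (charPolyList As)) w ≡⟨ evalDesc-mulXminus w (charPolyList As) w ⟩
  (w - w) * evalDesc (charPolyList As) w     ≡⟨ cong (_* evalDesc (charPolyList As) w) (ℤ.+-inverseʳ w) ⟩
  0ℤ                                         ∎
evalDesc-charPolyList-root {a ∷ As} {w} (there w∈) = begin
  evalDesc (mulXminus a (charPolyList As)) w ≡⟨ evalDesc-mulXminus a (charPolyList As) w ⟩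
  (w - a) * evalDesc (charPolyList As) w     ≡⟨ cong ((w - a) *_) (evalDesc-charPolyList-root w∈) ⟩
  (w - a) * 0ℤ                               ≡⟨ ℤ.*-zeroʳ (w - a) ⟩
  0ℤ                                         ∎

-- Divided differences

-- For nodes a ∷ r = a₀, …, a_α, divided a r i = h_{i-α}(a₀, …, a_α), the complete homogeneous
-- symmetric polynomial (0 in negative degree), so that pairing (divided a r) g is the divided
-- difference g[a₀, …, a_α].
divided : ℤ → List ℤ → ℕ → ℤ
divided a []      i       = a ^ i
divided a (b ∷ r) zero    = 0ℤ
divided a (b ∷ r) (suc i) = a * divided a (b ∷ r) i + divided b r i

divided-below : ∀ a r i → i < length r → divided a r i ≡ 0ℤ
divided-below a (b ∷ r) zero    _           = refl
divided-below a (b ∷ r) (suc i) (s≤s i<len) = begin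
  a * divided a (b ∷ r) i + divided b r i
    ≡⟨ cong₂ (λ u v → a * u + v) (divided-below a (b ∷ r) i (ℕ.m<n⇒m<1+n i<len)) (divided-below b r i i<len) ⟩
  a * 0ℤ + 0ℤ
    ≡⟨ cong (_+ 0ℤ) (ℤ.*-zeroʳ a) ⟩
  0ℤ
    ∎

divided-top : ∀ a r → divided a r (length r) ≡ 1ℤ
divided-top a []      = refl
divided-top a (b ∷ r) = begin
  a * divided a (b ∷ r) (length r) + divided b r (length r)
    ≡⟨ cong₂ (λ u v → a * u + v) (divided-below a (b ∷ r) (length r) ℕ.≤-refl) (divided-top b r) ⟩
  a * 0ℤ + 1ℤ
    ≡⟨ cong (_+ 1ℤ) (ℤ.*-zeroʳ a) ⟩
  1ℤ
    ∎

-- Bivariate polynomials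

-- Lists of rows: [F₀, F₁, …] is Σᵢ Xⁱ Fᵢ(Y), each row ascending in Y.
Poly₂ : Set
Poly₂ = List (List ℤ)

eval₂ : Poly₂ → ℤ → ℤ → ℤ
eval₂ F x y = eval (map (λ r → eval r y) F) x

pairing₂ : (ℕ → ℤ) → (ℕ → ℤ) → Poly₂ → ℤ
pairing₂ T U F = pairing T (map (pairing U) F)

infixl 6 _+₂_
_+₂_ : Poly₂ → Poly₂ → Poly₂
[]      +₂ G       = G
(r ∷ F) +₂ []      = r ∷ F
(r ∷ F) +₂ (s ∷ G) = r +ₚ s ∷ F +₂ G

mulX : Poly₂ → Poly₂
mulX F = [] ∷ F

mulY : Poly₂ → Poly₂
mulY = map (0ℤ ∷_)

mulX^ : ℕ → Poly₂ → Poly₂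
mulX^ zero    F = F
mulX^ (suc k) F = mulX (mulX^ k F)

mulY^ : ℕ → Poly₂ → Poly₂
mulY^ zero    F = F
mulY^ (suc k) F = mulY (mulY^ k F)

-- g(X + Y), by Horner's rule.
atSum : List ℤ → Poly₂
atSum []       = []
atSum (c ∷ cs) = ((c ∷ []) ∷ []) +₂ (mulX (atSum cs) +₂ mulY (atSum cs))

substX : Poly₂ → ℤ → List ℤ
substX []      x = []
substX (r ∷ F) x = r +ₚ scaleₚ x (substX F x)

map-+₂ : ∀ (f : List ℤ → ℤ) → (∀ r s → f (r +ₚ s) ≡ f r + f s) →
         ∀ F G → map f (F +₂ G) ≡ map f F +ₚ map f G
map-+₂ f f-+ []      G       = refl
map-+₂ f f-+ (r ∷ F) []      = refl
map-+₂ f f-+ (r ∷ F) (s ∷ G) = cong₂ _∷_ (f-+ r s) (map-+₂ f f-+ F G)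

eval₂-+₂ : ∀ F G x y → eval₂ (F +₂ G) x y ≡ eval₂ F x y + eval₂ G x y
eval₂-+₂ F G x y = trans (cong (λ l → eval l x) (map-+₂ (λ r → eval r y) (λ r s → eval-+ₚ r s y) F G))
                         (eval-+ₚ (map (λ r → eval r y) F) _ x)

pairing₂-+₂ : ∀ T U F G → pairing₂ T U (F +₂ G) ≡ pairing₂ T U F + pairing₂ T U G
pairing₂-+₂ T U F G = trans (cong (pairing T) (map-+₂ (pairing U) (pairing-+ₚ U) F G))
                            (pairing-+ₚ T (map (pairing U) F) _)

eval₂-mulX : ∀ F x y → eval₂ (mulX F) x y ≡ x * eval₂ F x y
eval₂-mulX F x y = ℤ.+-identityˡ _

pairing₂-mulX : ∀ T U F → pairing₂ T U (mulX F) ≡ pairing₂ (T ∘ suc) U F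
pairing₂-mulX T U F = ℤ.+-identityˡ _

eval₂-mulY : ∀ F x y → eval₂ (mulY F) x y ≡ y * eval₂ F x y
eval₂-mulY F x y = trans (cong (λ l → eval l x) (rows F)) (eval-scaleₚ y (map (λ r → eval r y) F) x)
  where
  rows : ∀ F → map (λ r → eval r y) (mulY F) ≡ scaleₚ y (map (λ r → eval r y) F)
  rows []      = refl
  rows (r ∷ F) = cong₂ _∷_ (ℤ.+-identityˡ _) (rows F)

pairing₂-mulY : ∀ T U F → pairing₂ T U (mulY F) ≡ pairing₂ T (U ∘ suc) F
pairing₂-mulY T U F = cong (pairing T) (rows F)
  where
  rows : ∀ F → map (pairing U) (mulY F) ≡ map (pairing (U ∘ suc)) F
  rows []      = refl
  rows (r ∷ F) = cong₂ _∷_ (ℤ.+-identityˡ _) (rows F)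

eval₂-mulX^ : ∀ k F x y → eval₂ (mulX^ k F) x y ≡ x ^ k * eval₂ F x y
eval₂-mulX^ zero    F x y = sym (ℤ.*-identityˡ _)
eval₂-mulX^ (suc k) F x y = begin
  eval₂ (mulX (mulX^ k F)) x y ≡⟨ eval₂-mulX (mulX^ k F) x y ⟩
  x * eval₂ (mulX^ k F) x y    ≡⟨ cong (x *_) (eval₂-mulX^ k F x y) ⟩
  x * (x ^ k * eval₂ F x y)    ≡⟨ ℤ.*-assoc x (x ^ k) _ ⟨
  x * x ^ k * eval₂ F x y      ∎

eval₂-mulY^ : ∀ k F x y → eval₂ (mulY^ k F) x y ≡ y ^ k * eval₂ F x y
eval₂-mulY^ zero    F x y = sym (ℤ.*-identityˡ _)
eval₂-mulY^ (suc k) F x y = begin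
  eval₂ (mulY (mulY^ k F)) x y ≡⟨ eval₂-mulY (mulY^ k F) x y ⟩
  y * eval₂ (mulY^ k F) x y    ≡⟨ cong (y *_) (eval₂-mulY^ k F x y) ⟩
  y * (y ^ k * eval₂ F x y)    ≡⟨ ℤ.*-assoc y (y ^ k) _ ⟨
  y * y ^ k * eval₂ F x y      ∎

pairing₂-mulX^ : ∀ k T U F → pairing₂ T U (mulX^ k F) ≡ pairing₂ (T ∘ (k ℕ.+_)) U F
pairing₂-mulX^ zero    T U F = refl
pairing₂-mulX^ (suc k) T U F = trans (pairing₂-mulX T U (mulX^ k F)) (pairing₂-mulX^ k (T ∘ suc) U F)

pairing₂-mulY^ : ∀ k T U F → pairing₂ T U (mulY^ k F) ≡ pairing₂ T (U ∘ (k ℕ.+_)) F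
pairing₂-mulY^ zero    T U F = refl
pairing₂-mulY^ (suc k) T U F = trans (pairing₂-mulY T U (mulY^ k F)) (pairing₂-mulY^ k T (U ∘ suc) F)

eval₂-atSum : ∀ g x y → eval₂ (atSum g) x y ≡ eval g (x + y)
eval₂-atSum []       x y = refl
eval₂-atSum (c ∷ cs) x y = begin
  eval₂ (((c ∷ []) ∷ []) +₂ (mulX R +₂ mulY R)) x y
    ≡⟨ eval₂-+₂ ((c ∷ []) ∷ []) (mulX R +₂ mulY R) x y ⟩
  eval₂ ((c ∷ []) ∷ []) x y + eval₂ (mulX R +₂ mulY R) x y
    ≡⟨ cong (_+_ (eval₂ ((c ∷ []) ∷ []) x y)) (eval₂-+₂ (mulX R) (mulY R) x y) ⟩
  eval₂ ((c ∷ []) ∷ []) x y + (eval₂ (mulX R) x y + eval₂ (mulY R) x y)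
    ≡⟨ cong₂ (λ u v → eval₂ ((c ∷ []) ∷ []) x y + (u + v)) (eval₂-mulX R x y) (eval₂-mulY R x y) ⟩
  c + y * 0ℤ + x * 0ℤ + (x * eval₂ R x y + y * eval₂ R x y)
    ≡⟨ cong (λ e → c + y * 0ℤ + x * 0ℤ + (x * e + y * e)) (eval₂-atSum cs x y) ⟩
  c + y * 0ℤ + x * 0ℤ + (x * eval cs (x + y) + y * eval cs (x + y))
    ≡⟨ rearrange c x y (eval cs (x + y)) ⟩
  c + (x + y) * eval cs (x + y)
    ∎
  where
  R = atSum cs
  rearrange : ∀ c x y e → c + y * 0ℤ + x * 0ℤ + (x * e + y * e) ≡ c + (x + y) * e
  rearrange = solve-∀

eval-substX : ∀ F x y → eval (substX F x) y ≡ eval₂ F x y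
eval-substX []      x y = refl
eval-substX (r ∷ F) x y = trans (eval-+ₚ r (scaleₚ x (substX F x)) y)
  (cong (_+_ (eval r y)) (trans (eval-scaleₚ x (substX F x) y) (cong (x *_) (eval-substX F x y))))

pairing-substX : ∀ U F x → pairing U (substX F x) ≡ eval (map (pairing U) F) x
pairing-substX U []      x = refl
pairing-substX U (r ∷ F) x = trans (pairing-+ₚ U r (scaleₚ x (substX F x)))
  (cong (_+_ (pairing U r)) (trans (pairing-scaleₚ U x (substX F x)) (cong (x *_) (pairing-substX U F x))))

-- pairing₂ T U ((X + Y)ᴷ), that is Σᵢ (K choose i) T(i) U(K - i).
W : (ℕ → ℤ) → (ℕ → ℤ) → ℕ → ℤ
W T U zero    = T 0 * U 0
W T U (suc K) = W (T ∘ suc) U K + W T (U ∘ suc) K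

pairing₂-atSum : ∀ T U g → pairing₂ T U (atSum g) ≡ pairing (W T U) g
pairing₂-atSum T U []       = refl
pairing₂-atSum T U (c ∷ cs) = begin
  pairing₂ T U (((c ∷ []) ∷ []) +₂ (mulX R +₂ mulY R))
    ≡⟨ pairing₂-+₂ T U ((c ∷ []) ∷ []) (mulX R +₂ mulY R) ⟩
  pairing₂ T U ((c ∷ []) ∷ []) + pairing₂ T U (mulX R +₂ mulY R)
    ≡⟨ cong (_+_ (pairing₂ T U ((c ∷ []) ∷ []))) (pairing₂-+₂ T U (mulX R) (mulY R)) ⟩
  pairing₂ T U ((c ∷ []) ∷ []) + (pairing₂ T U (mulX R) + pairing₂ T U (mulY R))
    ≡⟨ cong₂ (λ u v → pairing₂ T U ((c ∷ []) ∷ []) + (u + v))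
             (trans (pairing₂-mulX T U R) (pairing₂-atSum (T ∘ suc) U cs))
             (trans (pairing₂-mulY T U R) (pairing₂-atSum T (U ∘ suc) cs)) ⟩
  (c * U 0 + 0ℤ) * T 0 + 0ℤ + (pairing (W (T ∘ suc) U) cs + pairing (W T (U ∘ suc)) cs)
    ≡⟨ cong₂ _+_ (rearrange c (T 0) (U 0)) (sym (pairing-+seq (W (T ∘ suc) U) (W T (U ∘ suc)) cs)) ⟩
  c * (T 0 * U 0) + pairing (W T U ∘ suc) cs
    ∎
  where
  R = atSum cs
  rearrange : ∀ c t u → (c * u + 0ℤ) * t + 0ℤ ≡ c * (t * u)
  rearrange = solve-∀

W-closed : (P : ℤ → Set) → (∀ {x y} → P x → P y → P (x + y)) →
           ∀ T U K → (∀ i j → i ℕ.+ j ≡ K → P (T i * U j)) → P (W T U K)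
W-closed P P-+ T U zero    P-terms = P-terms 0 0 refl
W-closed P P-+ T U (suc K) P-terms = P-+
  (W-closed P P-+ (T ∘ suc) U K (λ i j i+j≡K → P-terms (suc i) j (cong suc i+j≡K)))
  (W-closed P P-+ T (U ∘ suc) K (λ i j i+j≡K → P-terms i (suc j) (trans (ℕ.+-suc i j) (cong suc i+j≡K))))

W-zero : ∀ T U K → (∀ i j → i ℕ.+ j ≡ K → T i * U j ≡ 0ℤ) → W T U K ≡ 0ℤ
W-zero = W-closed (_≡ 0ℤ) (λ x≡0 y≡0 → cong₂ _+_ x≡0 y≡0)

pascal : ∀ n k → + (n C k) + + (n C suc k) ≡ + (suc n C suc k)
pascal n k = trans (sym (ℤ.pos-+ (n C k) (n C suc k))) (cong +_ (nCk+nC[k+1]≡[n+1]C[k+1] n k))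

W-corner : ∀ T U t t' → (∀ i → i < t → T i ≡ 0ℤ) → T t ≡ 1ℤ →
           (∀ j → j < t' → U j ≡ 0ℤ) → U t' ≡ 1ℤ → W T U (t ℕ.+ t') ≡ + ((t ℕ.+ t') C t)
W-corner T U zero    zero     _       T₀≡1 _       U₀≡1 = cong₂ _*_ T₀≡1 U₀≡1
W-corner T U zero    (suc t') T-below T₀≡1 U-below U≡1 = cong₂ _+_
  (W-zero (T ∘ suc) U t' λ i j i+j≡t' →
    trans (cong (T (suc i) *_) (U-below j (s≤s (ℕ.m+n≤o⇒n≤o i (ℕ.≤-reflexive i+j≡t'))))) (ℤ.*-zeroʳ (T (suc i))))
  (W-corner T (U ∘ suc) zero t' T-below T₀≡1 (λ j j<t' → U-below (suc j) (s≤s j<t')) U≡1)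
W-corner T U (suc t) zero    T-below T≡1 U-below U₀≡1 = begin
  W (T ∘ suc) U (t ℕ.+ 0) + W T (U ∘ suc) (t ℕ.+ 0)
    ≡⟨ cong₂ _+_ (W-corner (T ∘ suc) U t zero (λ i i<t → T-below (suc i) (s≤s i<t)) T≡1 U-below U₀≡1)
                 (W-zero T (U ∘ suc) (t ℕ.+ 0) λ i j i+j≡t → cong (_* U (suc j))
                   (T-below i (s≤s (ℕ.m+n≤o⇒m≤o i (ℕ.≤-reflexive (trans i+j≡t (ℕ.+-identityʳ t))))))) ⟩
  + ((t ℕ.+ 0) C t) + 0ℤ
    ≡⟨ ℤ.+-identityʳ _ ⟩
  + ((t ℕ.+ 0) C t)
    ≡⟨ cong (λ n → + (n C t)) (ℕ.+-identityʳ t) ⟩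
  + (t C t)
    ≡⟨ cong +_ (trans (nCn≡1 t) (sym (nCn≡1 (suc t)))) ⟩
  + (suc t C suc t)
    ≡⟨ cong (λ n → + (suc n C suc t)) (ℕ.+-identityʳ t) ⟨
  + (suc (t ℕ.+ 0) C suc t)
    ∎
W-corner T U (suc t) (suc t') T-below T≡1 U-below U≡1 = begin
  W (T ∘ suc) U (t ℕ.+ suc t') + W T (U ∘ suc) (t ℕ.+ suc t')
    ≡⟨ cong₂ _+_ (W-corner (T ∘ suc) U t (suc t') (λ i i<t → T-below (suc i) (s≤s i<t)) T≡1 U-below U≡1)
                 (cong (W T (U ∘ suc)) (ℕ.+-suc t t')) ⟩
  + ((t ℕ.+ suc t') C t) + W T (U ∘ suc) (suc t ℕ.+ t')
    ≡⟨ cong (_+_ (+ ((t ℕ.+ suc t') C t)))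
            (W-corner T (U ∘ suc) (suc t) t' T-below T≡1 (λ j j<t' → U-below (suc j) (s≤s j<t')) U≡1) ⟩
  + ((t ℕ.+ suc t') C t) + + ((suc t ℕ.+ t') C suc t)
    ≡⟨ cong (λ n → + ((t ℕ.+ suc t') C t) + + (n C suc t)) (ℕ.+-suc t t') ⟨
  + ((t ℕ.+ suc t') C t) + + ((t ℕ.+ suc t') C suc t)
    ≡⟨ pascal (t ℕ.+ suc t') t ⟩
  + (suc (t ℕ.+ suc t') C suc t)
    ∎

shiftedAtSum : ℕ → ℕ → List ℤ → Poly₂
shiftedAtSum u v P = mulX^ u (mulY^ v (atSum (reverse P)))

eval₂-shiftedAtSum : ∀ u v P x y → eval₂ (shiftedAtSum u v P) x y ≡ x ^ u * (y ^ v * evalDesc P (x + y))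
eval₂-shiftedAtSum u v P x y = begin
  eval₂ (mulX^ u (mulY^ v (atSum (reverse P)))) x y ≡⟨ eval₂-mulX^ u _ x y ⟩
  x ^ u * eval₂ (mulY^ v (atSum (reverse P))) x y   ≡⟨ cong (x ^ u *_) (eval₂-mulY^ v _ x y) ⟩
  x ^ u * (y ^ v * eval₂ (atSum (reverse P)) x y)   ≡⟨ cong (λ e → x ^ u * (y ^ v * e)) (eval₂-atSum (reverse P) x y) ⟩
  x ^ u * (y ^ v * eval (reverse P) (x + y))        ≡⟨ cong (λ e → x ^ u * (y ^ v * e)) (eval-reverse P (x + y)) ⟩
  x ^ u * (y ^ v * evalDesc P (x + y))              ∎

pairing₂-shiftedAtSum : ∀ u v T U P →
  pairing₂ T U (shiftedAtSum u v P) ≡ pairingDesc (W (T ∘ (u ℕ.+_)) (U ∘ (v ℕ.+_))) P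
pairing₂-shiftedAtSum u v T U P = begin
  pairing₂ T U (mulX^ u (mulY^ v (atSum (reverse P))))   ≡⟨ pairing₂-mulX^ u T U _ ⟩
  pairing₂ T′ U (mulY^ v (atSum (reverse P)))            ≡⟨ pairing₂-mulY^ v T′ U _ ⟩
  pairing₂ T′ U′ (atSum (reverse P))                     ≡⟨ pairing₂-atSum T′ U′ (reverse P) ⟩
  pairing (W T′ U′) (reverse P)                          ≡⟨ pairing-reverse (W T′ U′) P ⟩
  pairingDesc (W T′ U′) P                                ∎
  where
  T′ = T ∘ (u ℕ.+_)
  U′ = U ∘ (v ℕ.+_)

≤+⇒split : ∀ α β N → N ≤ α ℕ.+ β → ∃₂ λ t t' → t ≤ α × t' ≤ β × t ℕ.+ t' ≡ N
≤+⇒split zero    β N       N≤β      = 0 , N , z≤n , N≤β , refl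
≤+⇒split (suc α) β zero    _        = 0 , 0 , z≤n , z≤n , refl
≤+⇒split (suc α) β (suc N) (s≤s N≤α+β) with ≤+⇒split α β N N≤α+β
... | t , t' , t≤α , t'≤β , t+t'≡N = suc t , t' , s≤s t≤α , t'≤β , cong suc t+t'≡N

offsets-sum : ∀ u v t t' {α β N} → u ℕ.+ t ≡ α → v ℕ.+ t' ≡ β → t ℕ.+ t' ≡ N →
              u ℕ.+ v ℕ.+ N ≡ α ℕ.+ β
offsets-sum u v t t' refl refl refl = interchange u v t t'

n+m∸i≡n⇒i≡m : ∀ {n m i} → i ≤ n ℕ.+ m → n ℕ.+ m ∸ i ≡ n → i ≡ m
n+m∸i≡n⇒i≡m {n} {m} {i} i≤n+m eq = ℕ.+-cancelʳ-≡ n i m (begin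
  i ℕ.+ n             ≡⟨ cong (i ℕ.+_) eq ⟨
  i ℕ.+ (n ℕ.+ m ∸ i) ≡⟨ ℕ.m+[n∸m]≡n i≤n+m ⟩
  n ℕ.+ m             ≡⟨ ℕ.+-comm n m ⟩
  m ℕ.+ n             ∎)

-- Finite subsets as lists of integers

toℤ : ∀ {n} → Fin n → ℤ
toℤ x = + toℕ x

elemsℤ : ∀ {n} → Subset n → List ℤ
elemsℤ S = map toℤ (elems S)

length-elemsℤ : ∀ {n} (S : Subset n) → length (elemsℤ S) ≡ ∣ S ∣
length-elemsℤ S = trans (length-map toℤ (elems S)) (length-elems S)
  where
  length-elems : ∀ {n} (S : Subset n) → length (elems S) ≡ ∣ S ∣
  length-elems []          = refl
  length-elems (true  ∷ S) = cong suc (trans (length-map Fin.suc (elems S)) (length-elems S))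
  length-elems (false ∷ S) = trans (length-map Fin.suc (elems S)) (length-elems S)

∈-elems⁺ : ∀ {n} {S : Subset n} {x} → x ∈ₛ S → x ∈ elems S
∈-elems⁺ {S = true  ∷ S} here      = here refl
∈-elems⁺ {S = true  ∷ S} (there x∈) = there (∈-map⁺ Fin.suc (∈-elems⁺ x∈))
∈-elems⁺ {S = false ∷ S} (there x∈) = ∈-map⁺ Fin.suc (∈-elems⁺ x∈)

∈-elems⁻ : ∀ {n} {S : Subset n} {x} → x ∈ elems S → x ∈ₛ S
∈-elems⁻ {S = true  ∷ S} (here refl) = here
∈-elems⁻ {S = true  ∷ S} (there x∈) with ∈-map⁻ Fin.suc x∈
... | y , y∈ , refl = there (∈-elems⁻ y∈)
∈-elems⁻ {S = false ∷ S} x∈ with ∈-map⁻ Fin.suc x∈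
... | y , y∈ , refl = there (∈-elems⁻ y∈)

elems-unique : ∀ {n} (S : Subset n) → Unique (elems S)
elems-unique []          = []
elems-unique (true  ∷ S) = All.map⁺ (All.tabulate (λ _ ())) ∷ Unique.map⁺ Fin.suc-injective (elems-unique S)
elems-unique (false ∷ S) = Unique.map⁺ Fin.suc-injective (elems-unique S)

charPoly≡charPolyList : ∀ {n} (S : Subset n) → charPoly S ≡ charPolyList (elemsℤ S)
charPoly≡charPolyList S = sym (foldr-map mulXminus toℤ (1ℤ ∷ []) (elems S))

nCk*k!*[n∸k]!≡n! : ∀ {n k} → k ≤ n → (n C k) ℕ.* (k ! ℕ.* (n ∸ k) !) ≡ n !
nCk*k!*[n∸k]!≡n! {n} {k} k≤n = let instance _ = k !* (n ∸ k) !≢0 in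
  trans (cong (ℕ._* (k ! ℕ.* (n ∸ k) !)) (nCk≡n!/k![n-k]! k≤n)) (m/n*n≡m (k![n∸k]!∣n! k≤n))

module _ {p : ℕ} (pr : Prime p) where
  private instance
    p≢0 : ℕ.NonZero p
    p≢0 = prime⇒nonZero pr

  p∣0 : + p ∣ 0ℤ
  p∣0 = divides 0ℤ refl

  p∣-cancel : ∀ {x y} → + p ∣ x - y → + p ∣ y → + p ∣ x
  p∣-cancel p∣x-y p∣y = ∣m+n∣n⇒∣m p∣x-y (∣m⇒∣-m p∣y)

  euclid : ∀ {x y} → + p ∣ x * y → (+ p ∣ x) ⊎ (+ p ∣ y)
  euclid {x} {y} p∣xy = Sum.map ∣ᵤ⇒∣ ∣ᵤ⇒∣
    (euclidsLemma ℤ.∣ x ∣ ℤ.∣ y ∣ pr (subst (p ℕ.∣_) (ℤ.abs-* x y) (∣⇒∣ᵤ p∣xy)))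

  p∣^-^ : ∀ {z w} n → + p ∣ z - w → + p ∣ z ^ n - w ^ n
  p∣^-^         zero    _     = p∣0
  p∣^-^ {z} {w} (suc n) p∣z-w = subst (+ p ∣_) (rearrange z w (z ^ n) (w ^ n))
    (∣m∣n⇒∣m+n (∣n⇒∣m*n z (p∣^-^ n p∣z-w)) (∣n⇒∣m*n (w ^ n) p∣z-w))
    where
    rearrange : ∀ z w a b → z * (a - b) + b * (z - w) ≡ z * a - w * b
    rearrange = solve-∀

  p∣evalDesc-cong : ∀ {z w} P → + p ∣ z - w → + p ∣ evalDesc P z - evalDesc P w
  p∣evalDesc-cong         []       _     = p∣0
  p∣evalDesc-cong {z} {w} (c ∷ cs) p∣z-w = subst (+ p ∣_) (rearrange c (z ^ length cs) (w ^ length cs) _ _)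
    (∣m∣n⇒∣m+n (∣n⇒∣m*n c (p∣^-^ (length cs) p∣z-w)) (p∣evalDesc-cong cs p∣z-w))
    where
    rearrange : ∀ c a b e f → c * (a - b) + (e - f) ≡ c * a + e - (c * b + f)
    rearrange = solve-∀

  p∤! : ∀ n → n < p → ¬ (p ℕ.∣ n !)
  p∤! zero    _   p∣1   = ¬prime[1] (subst Prime (ℕ.∣1⇒≡1 p∣1) pr)
  p∤! (suc n) n<p p∣n!′ with euclidsLemma (suc n) (n !) pr p∣n!′
  ... | inj₁ p∣1+n = ℕ.<⇒≱ n<p (ℕ.∣⇒≤ p∣1+n)
  ... | inj₂ p∣n!  = p∤! n (ℕ.<-trans (ℕ.n<1+n n) n<p) p∣n!

  p∤C : ∀ {n k} → k ≤ n → n < p → ¬ (+ p ∣ + (n C k))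
  p∤C {n} {k} k≤n n<p p∣C =
    p∤! n n<p (subst (p ℕ.∣_) (nCk*k!*[n∸k]!≡n! k≤n) (ℕ.∣m⇒∣m*n _ (∣⇒∣ᵤ p∣C)))

  Distinct : List ℤ → Set
  Distinct = AllPairs (λ a b → ¬ (+ p ∣ b - a))

  -- A divided difference vanishes when g vanishes at all (distinct) nodes: peel off the node a
  -- using g = (X - a) · quotient g a + g(a), where p ∤ x - a for the remaining nodes x.
  p∣pairing-divided : ∀ {a r} → Distinct (a ∷ r) → ∀ g → (∀ {x} → x ∈ a ∷ r → + p ∣ eval g x) →
                      + p ∣ pairing (divided a r) g
  p∣pairing-divided {a} {[]}    _                   g g≡0 = subst (+ p ∣_) (sym (pairing-powers a g)) (g≡0 (here refl))
  p∣pairing-divided {a} {b ∷ r} (a≉r ∷ distinct) g g≡0 =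
    subst (+ p ∣_) (sym (pairing-quotient a (divided a (b ∷ r)) (divided b r) (λ _ → refl) g))
      (∣m∣n⇒∣m+n (∣m⇒∣m*n _ (g≡0 (here refl))) (p∣pairing-divided distinct (quotient g a) q≡0))
    where
    q≡0 : ∀ {x} → x ∈ b ∷ r → + p ∣ eval (quotient g a) x
    q≡0 {x} x∈ with euclid (∣m+n∣n⇒∣m (subst (+ p ∣_) (sym (eval-quotient g a x)) (g≡0 (there x∈)))
                                       (g≡0 (here refl)))
    ... | inj₁ p∣x-a = ⊥-elim (All.lookup a≉r x∈ p∣x-a)
    ... | inj₂ p∣q   = p∣q

  NullCoeffs : ℕ → List ℤ → Set
  NullCoeffs m P = ∀ k → 1 ≤ k → k ≤ m → + p ∣ coeff P k

  termDesc : (ℕ → ℤ) → List ℤ → ℕ → ℤ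
  termDesc T Q i = coeff Q i * T (length Q ∸ suc i)

  p∣pairingDesc⇒p∣term : ∀ T Q i₀ → (∀ i → i ≢ i₀ → i < length Q → + p ∣ termDesc T Q i) →
                          + p ∣ pairingDesc T Q → + p ∣ termDesc T Q i₀
  p∣pairingDesc⇒p∣term T []       i₀       _          _ = p∣0
  p∣pairingDesc⇒p∣term T (c ∷ cs) zero     p∣others p∣Σ =
    ∣m+n∣n⇒∣m p∣Σ (p∣pairingDesc T cs (λ i i< → p∣others (suc i) (λ ()) (s≤s i<)))
    where
    p∣pairingDesc : ∀ T Q → (∀ i → i < length Q → + p ∣ termDesc T Q i) → + p ∣ pairingDesc T Q
    p∣pairingDesc T []       _        = p∣0
    p∣pairingDesc T (c ∷ cs) p∣terms =
      ∣m∣n⇒∣m+n (p∣terms 0 (s≤s z≤n)) (p∣pairingDesc T cs (λ i i< → p∣terms (suc i) (s≤s i<)))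
  p∣pairingDesc⇒p∣term T (c ∷ cs) (suc j) p∣others p∣Σ =
    p∣pairingDesc⇒p∣term T cs j (λ i i≢j i< → p∣others (suc i) (i≢j ∘ ℕ.suc-injective) (s≤s i<))
      (∣m+n∣m⇒∣n p∣Σ (p∣others 0 (λ ()) (s≤s z≤n)))

  p∣divided-beyond : ∀ {a r m} → Distinct (a ∷ r) → NullCoeffs m (charPolyList (a ∷ r)) →
                     ∀ k → k < m → + p ∣ divided a r (suc (length r ℕ.+ k))
  p∣divided-beyond {a} {r} {m} distinct null k k<m =
    subst (+ p ∣_) leading (p∣pairingDesc⇒p∣term T′ Π 0 others p∣Σ)
    where
    T = divided a r
    T′ = T ∘ (k ℕ.+_)
    Π = charPolyList (a ∷ r)
    α = length r
    len-Π : length Π ≡ suc (suc α)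
    len-Π = length-charPolyList (a ∷ r)

    -- the divided difference of Xᵏ Π, which vanishes at the nodes
    p∣Σ : + p ∣ pairingDesc T′ Π
    p∣Σ = subst (+ p ∣_) (trans (pairing-pad k T (reverse Π)) (pairing-reverse T′ Π))
      (p∣pairing-divided distinct (pad k (reverse Π)) λ {x} x∈ →
        subst (+ p ∣_) (sym (begin
          eval (pad k (reverse Π)) x ≡⟨ eval-pad k (reverse Π) x ⟩
          x ^ k * eval (reverse Π) x ≡⟨ cong (x ^ k *_) (eval-reverse Π x) ⟩
          x ^ k * evalDesc Π x       ≡⟨ cong (x ^ k *_) (evalDesc-charPolyList-root x∈) ⟩
          x ^ k * 0ℤ                 ≡⟨ ℤ.*-zeroʳ (x ^ k) ⟩
          0ℤ                         ∎)) p∣0)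

    index-below : ∀ {i} → suc k < i → i ≤ suc α → k ℕ.+ (suc α ∸ i) < α
    index-below {suc i} (s≤s k<i) (s≤s i≤α) =
      subst (k ℕ.+ (α ∸ i) <_) (ℕ.m+[n∸m]≡n i≤α) (ℕ.+-monoˡ-< (α ∸ i) k<i)

    others : ∀ i → i ≢ 0 → i < length Π → + p ∣ termDesc T′ Π i
    others i i≢0 i<len with i ℕ.≤? suc k
    ... | yes i≤1+k = ∣m⇒∣m*n _ (null i (ℕ.n≢0⇒n>0 i≢0) (ℕ.≤-trans i≤1+k k<m))
    ... | no  i≰1+k = subst (+ p ∣_) (sym T′≡0) p∣0
      where
      T′≡0 : termDesc T′ Π i ≡ 0ℤ
      T′≡0 = begin
        coeff Π i * T′ (length Π ∸ suc i)       ≡⟨ cong (λ n → coeff Π i * T′ (n ∸ suc i)) len-Π ⟩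
        coeff Π i * T (k ℕ.+ (suc α ∸ i))       ≡⟨ cong (coeff Π i *_) (divided-below a r _
                                                      (index-below (ℕ.≰⇒> i≰1+k) (ℕ.≤-pred (subst (i <_) len-Π i<len)))) ⟩
        coeff Π i * 0ℤ                          ≡⟨ ℤ.*-zeroʳ (coeff Π i) ⟩
        0ℤ                                      ∎

    leading : termDesc T′ Π 0 ≡ divided a r (suc (α ℕ.+ k))
    leading = begin
      coeff Π 0 * T (k ℕ.+ (length Π ∸ 1))
        ≡⟨ cong₂ (λ c n → c * T (k ℕ.+ (n ∸ 1))) (charPolyList-monic (a ∷ r)) len-Π ⟩
      1ℤ * T (k ℕ.+ suc α)
        ≡⟨ ℤ.*-identityˡ _ ⟩
      T (k ℕ.+ suc α)
        ≡⟨ cong T (trans (ℕ.+-suc k α) (cong suc (ℕ.+-comm k α))) ⟩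
      T (suc (α ℕ.+ k))
        ∎

  record DividedShape (m α : ℕ) (T : ℕ → ℤ) : Set where
    field
      below  : ∀ i → i < α → T i ≡ 0ℤ
      at     : T α ≡ 1ℤ
      beyond : ∀ i → α < i → i ≤ α ℕ.+ m → + p ∣ T i

  divided-shape : ∀ {a r m} → Distinct (a ∷ r) → NullCoeffs m (charPolyList (a ∷ r)) →
                  DividedShape m (length r) (divided a r)
  divided-shape {a} {r} {m} distinct null = record
    { below = divided-below a r ; at = divided-top a r ; beyond = beyond }
    where
    beyond : ∀ i → length r < i → i ≤ length r ℕ.+ m → + p ∣ divided a r i
    beyond i α<i i≤α+m with ℕ.m≤n⇒∃[o]m+o≡n α<i
    ... | k , refl = p∣divided-beyond distinct null k
      (ℕ.+-cancelˡ-≤ (length r) (suc k) m (subst (_≤ length r ℕ.+ m) (sym (ℕ.+-suc (length r) k)) i≤α+m))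

  p∣product : ∀ {m α β T U} → DividedShape m α T → DividedShape m β U →
              ∀ i j → i ℕ.+ j ≤ α ℕ.+ β ℕ.+ m → i ℕ.+ j ≢ α ℕ.+ β → + p ∣ T i * U j
  p∣product {m} {α} {β} {T} {U} sT sU i j i+j≤ i+j≢ with i ℕ.<? α | j ℕ.<? β
  ... | yes i<α | _       = subst (+ p ∣_) (sym (cong (_* U j) (DividedShape.below sT i i<α))) p∣0
  ... | no _    | yes j<β = subst (+ p ∣_) (sym (trans (cong (T i *_) (DividedShape.below sU j j<β)) (ℤ.*-zeroʳ (T i)))) p∣0
  ... | no i≮α  | no j≮β with i ℕ.≟ α
  ...   | no i≢α  = ∣m⇒∣m*n (U j) (DividedShape.beyond sT i (ℕ.≤∧≢⇒< (ℕ.≮⇒≥ i≮α) (i≢α ∘ sym)) i≤α+m)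
    where
    i≤α+m : i ≤ α ℕ.+ m
    i≤α+m = ℕ.+-cancelʳ-≤ β i (α ℕ.+ m) (ℕ.≤-trans (ℕ.+-monoʳ-≤ i (ℕ.≮⇒≥ j≮β))
              (subst (i ℕ.+ j ≤_) (xy∙z≈xz∙y α β m) i+j≤))
  ...   | yes refl = ∣n⇒∣m*n (T i) (DividedShape.beyond sU j (ℕ.≤∧≢⇒< (ℕ.≮⇒≥ j≮β) (j≢β ∘ sym)) j≤β+m)
    where
    j≢β : j ≢ β
    j≢β refl = i+j≢ refl
    j≤β+m : j ≤ β ℕ.+ m
    j≤β+m = ℕ.+-cancelˡ-≤ i j (β ℕ.+ m) (subst (i ℕ.+ j ≤_) (ℕ.+-assoc i β m) i+j≤)

  p∣W-shifted : ∀ {m α β T U} → DividedShape m α T → DividedShape m β U → ∀ u v K →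
                u ℕ.+ v ℕ.+ K ≤ α ℕ.+ β ℕ.+ m → u ℕ.+ v ℕ.+ K ≢ α ℕ.+ β →
                + p ∣ W (T ∘ (u ℕ.+_)) (U ∘ (v ℕ.+_)) K
  p∣W-shifted {m} {α} {β} sT sU u v K ≤α+β+m ≢α+β = W-closed (+ p ∣_) ∣m∣n⇒∣m+n _ _ K λ i j i+j≡K →
    let indices = trans (interchange u i v j) (cong (u ℕ.+ v ℕ.+_) i+j≡K) in
    p∣product sT sU (u ℕ.+ i) (v ℕ.+ j)
      (subst (_≤ α ℕ.+ β ℕ.+ m) (sym indices) ≤α+β+m) (≢α+β ∘ trans (sym indices))

  W-corner-shifted : ∀ {m α β T U} u v t t' → DividedShape m α T → DividedShape m β U →
                     u ℕ.+ t ≡ α → v ℕ.+ t' ≡ β →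
                     W (T ∘ (u ℕ.+_)) (U ∘ (v ℕ.+_)) (t ℕ.+ t') ≡ + ((t ℕ.+ t') C t)
  W-corner-shifted u v t t' sT sU refl refl = W-corner _ _ t t'
    (λ i i<t → DividedShape.below sT (u ℕ.+ i) (ℕ.+-monoʳ-< u i<t)) (DividedShape.at sT)
    (λ j j<t' → DividedShape.below sU (v ℕ.+ j) (ℕ.+-monoʳ-< v j<t')) (DividedShape.at sU)

  p∣pairing₂-divided : ∀ {a ra b rb} → Distinct (a ∷ ra) → Distinct (b ∷ rb) →
                       ∀ F → (∀ {x y} → x ∈ a ∷ ra → y ∈ b ∷ rb → + p ∣ eval₂ F x y) →
                       + p ∣ pairing₂ (divided a ra) (divided b rb) F
  p∣pairing₂-divided {b = b} {rb} dA dB F F≡0 = p∣pairing-divided dA (map (pairing (divided b rb)) F) λ {x} x∈ →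
    subst (+ p ∣_) (pairing-substX (divided b rb) F x)
      (p∣pairing-divided dB (substX F x) λ {y} y∈ → subst (+ p ∣_) (sym (eval-substX F x y)) (F≡0 x∈ y∈))

  -- divided(A) ⊗ divided(B) kills Xᵘ Yᵛ P(X + Y). As u + v + N = α + β, the W-value paired with coeff P i
  -- has total index u + v + N + m - i, which for i ≠ m lies below α + β or in the band (α + β, α + β + m]
  -- where it vanishes; the one for i = m is (N choose t).
  p∣coeff*binomial : ∀ {a ra b rb m N} (P : List ℤ) → Distinct (a ∷ ra) → Distinct (b ∷ rb) →
    NullCoeffs m (charPolyList (a ∷ ra)) → NullCoeffs m (charPolyList (b ∷ rb)) → length P ≡ suc (N ℕ.+ m) →
    (∀ {x y} → x ∈ a ∷ ra → y ∈ b ∷ rb → + p ∣ evalDesc P (x + y)) →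
    ∀ {u v t t'} → u ℕ.+ t ≡ length ra → v ℕ.+ t' ≡ length rb → t ℕ.+ t' ≡ N → + p ∣ coeff P m * + (N C t)
  p∣coeff*binomial {a} {ra} {b} {rb} {m} {N} P dA dB nullA nullB len-P P≡0 {u} {v} {t} {t'} u+t≡α v+t'≡β t+t'≡N =
    subst (+ p ∣_) single (p∣pairingDesc⇒p∣term (W T′ U′) P m others p∣Σ)
    where
    sA = divided-shape dA nullA
    sB = divided-shape dB nullB
    T′ = divided a ra ∘ (u ℕ.+_)
    U′ = divided b rb ∘ (v ℕ.+_)

    p∣Σ : + p ∣ pairingDesc (W T′ U′) P
    p∣Σ = subst (+ p ∣_) (pairing₂-shiftedAtSum u v (divided a ra) (divided b rb) P)
      (p∣pairing₂-divided dA dB (shiftedAtSum u v P) λ {x} {y} x∈ y∈ →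
        subst (+ p ∣_) (sym (eval₂-shiftedAtSum u v P x y)) (∣n⇒∣m*n (x ^ u) (∣n⇒∣m*n (y ^ v) (P≡0 x∈ y∈))))

    u+v+N≡α+β : u ℕ.+ v ℕ.+ N ≡ length ra ℕ.+ length rb
    u+v+N≡α+β = offsets-sum u v t t' u+t≡α v+t'≡β t+t'≡N

    others : ∀ i → i ≢ m → i < length P → + p ∣ termDesc (W T′ U′) P i
    others i i≢m i<len = subst (λ n → + p ∣ coeff P i * W T′ U′ (n ∸ suc i)) (sym len-P)
      (∣n⇒∣m*n (coeff P i)
        (p∣W-shifted sA sB u v (N ℕ.+ m ∸ i) bound (i≢m ∘ n+m∸i≡n⇒i≡m i≤N+m ∘ off-corner)))
      where
      i≤N+m : i ≤ N ℕ.+ m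
      i≤N+m = ℕ.≤-pred (subst (i <_) len-P i<len)
      bound : u ℕ.+ v ℕ.+ (N ℕ.+ m ∸ i) ≤ length ra ℕ.+ length rb ℕ.+ m
      bound = subst (u ℕ.+ v ℕ.+ (N ℕ.+ m ∸ i) ≤_)
                (trans (sym (ℕ.+-assoc (u ℕ.+ v) N m)) (cong (ℕ._+ m) u+v+N≡α+β))
                (ℕ.+-monoʳ-≤ (u ℕ.+ v) (ℕ.m∸n≤m (N ℕ.+ m) i))
      off-corner : u ℕ.+ v ℕ.+ (N ℕ.+ m ∸ i) ≡ length ra ℕ.+ length rb → N ℕ.+ m ∸ i ≡ N
      off-corner eq = ℕ.+-cancelˡ-≡ (u ℕ.+ v) _ _ (trans eq (sym u+v+N≡α+β))

    single : termDesc (W T′ U′) P m ≡ coeff P m * + (N C t)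
    single = cong (coeff P m *_) (begin
      W T′ U′ (length P ∸ suc m)  ≡⟨ cong (λ n → W T′ U′ (n ∸ suc m)) len-P ⟩
      W T′ U′ (N ℕ.+ m ∸ m)       ≡⟨ cong (W T′ U′) (ℕ.m+n∸n≡m N m) ⟩
      W T′ U′ N                   ≡⟨ cong (W T′ U′) t+t'≡N ⟨
      W T′ U′ (t ℕ.+ t')          ≡⟨ W-corner-shifted u v t t' sA sB u+t≡α v+t'≡β ⟩
      + ((t ℕ.+ t') C t)          ≡⟨ cong (λ n → + (n C t)) t+t'≡N ⟩
      + (N C t)                   ∎)

  sumset-degree-bound : ∀ {As Bs m N x y} (P : List ℤ) → x ∈ As → y ∈ Bs → Distinct As → Distinct Bs →
    NullCoeffs m (charPolyList As) → NullCoeffs m (charPolyList Bs) →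
    length P ≡ suc (N ℕ.+ m) → N < p → ¬ (+ p ∣ coeff P m) →
    (∀ {x y} → x ∈ As → y ∈ Bs → + p ∣ evalDesc P (x + y)) →
    length As ℕ.+ length Bs ≤ suc N
  sumset-degree-bound {a ∷ ra} {b ∷ rb} {N = N} P _ _ dA dB nullA nullB len-P N<p p∤Pm P≡0 =
    subst (_≤ suc N) (cong suc (sym (ℕ.+-suc (length ra) (length rb)))) (s≤s (ℕ.≰⇒> N≰α+β))
    where
    N≰α+β : ¬ (N ≤ length ra ℕ.+ length rb)
    N≰α+β N≤α+β with ≤+⇒split (length ra) (length rb) N N≤α+β
    ... | t , t' , t≤α , t'≤β , t+t'≡N
      with euclid (p∣coeff*binomial P dA dB nullA nullB len-P P≡0 {u = length ra ∸ t} {length rb ∸ t'}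
                     (ℕ.m∸n+n≡m t≤α) (ℕ.m∸n+n≡m t'≤β) t+t'≡N)
    ... | inj₁ p∣Pm = p∤Pm p∣Pm
    ... | inj₂ p∣C  = p∤C (subst (t ≤_) t+t'≡N (ℕ.m≤m+n t t')) N<p p∣C

  n<p∧p∣n⇒n≡0 : ∀ {n} → n < p → p ℕ.∣ n → n ≡ 0
  n<p∧p∣n⇒n≡0 {zero}  _   _   = refl
  n<p∧p∣n⇒n≡0 {suc n} n<p p∣n = ⊥-elim (ℕ.>⇒∤ n<p p∣n)

  p∣∣m⊖n∣⇒≡ : ∀ {x y} → x ≤ y → y < p → p ℕ.∣ ℤ.∣ x ⊖ y ∣ → x ≡ y
  p∣∣m⊖n∣⇒≡ {x} {y} x≤y y<p p∣∣x⊖y∣ = ℕ.≤-antisym x≤y (ℕ.m∸n≡0⇒m≤n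
    (n<p∧p∣n⇒n≡0 (ℕ.≤-<-trans (ℕ.m∸n≤m y x) y<p) (subst (p ℕ.∣_) (ℤ.∣⊖∣-≤ x≤y) p∣∣x⊖y∣)))

  toℕ-injective-mod : ∀ {x y} → x < p → y < p → + p ∣ + x - + y → x ≡ y
  toℕ-injective-mod {x} {y} x<p y<p p∣x-y =
    from-∣x⊖y∣ (subst (p ℕ.∣_) (cong ℤ.∣_∣ (ℤ.m-n≡m⊖n x y)) (∣⇒∣ᵤ p∣x-y))
    where
    from-∣x⊖y∣ : p ℕ.∣ ℤ.∣ x ⊖ y ∣ → x ≡ y
    from-∣x⊖y∣ p∣∣x⊖y∣ with ℕ.≤-total x y
    ... | inj₁ x≤y = p∣∣m⊖n∣⇒≡ x≤y y<p p∣∣x⊖y∣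
    ... | inj₂ y≤x = sym (p∣∣m⊖n∣⇒≡ y≤x x<p (subst (p ℕ.∣_) (ℤ.∣m⊖n∣≡∣n⊖m∣ x y) p∣∣x⊖y∣))

  p∣m-m%p : ∀ m → + p ∣ + m - + (m % p)
  p∣m-m%p m = divides (+ (m / p)) (begin
    + m - + (m % p)
      ≡⟨ cong (λ n → + n - + (m % p)) (m≡m%n+[m/n]*n m p) ⟩
    + (m % p ℕ.+ m / p ℕ.* p) - + (m % p)
      ≡⟨ cong (_- + (m % p)) (trans (ℤ.pos-+ (m % p) _) (cong (_+_ (+ (m % p))) (ℤ.pos-* (m / p) p))) ⟩
    + (m % p) + + (m / p) * + p - + (m % p)
      ≡⟨ cancel (+ (m % p)) (+ (m / p) * + p) ⟩
    + (m / p) * + p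
      ∎)
    where
    cancel : ∀ r x → r + x - r ≡ x
    cancel = solve-∀

  p∣⊕ : ∀ (a b : Fin p) → + p ∣ toℤ a + toℤ b - toℤ (a ⊕[ pr ] b)
  p∣⊕ a b = subst (+ p ∣_)
    (cong₂ _-_ (ℤ.pos-+ (toℕ a) (toℕ b)) (cong +_ (sym (Fin.toℕ-fromℕ< (m%n<n (toℕ a ℕ.+ toℕ b) p)))))
    (p∣m-m%p (toℕ a ℕ.+ toℕ b))

  distinct-elemsℤ : (S : Subset p) → Distinct (elemsℤ S)
  distinct-elemsℤ S = AllPairs.map⁺ (AllPairs.map (λ x≢y p∣y-x → x≢y (sym (Fin.toℕ-injective
    (toℕ-injective-mod (Fin.toℕ<n _) (Fin.toℕ<n _) p∣y-x)))) (elems-unique S))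

  null-coeffs : ∀ {A : Subset p} {l m} → IsNull A l → m ≤ l → NullCoeffs m (charPolyList (elemsℤ A))
  null-coeffs {A} (_ , p∣coeffs) m≤l k 1≤k k≤m =
    ∣ᵤ⇒∣ (subst (λ Q → (+ p) ∣ᵤ coeff Q k) (charPoly≡charPolyList A) (p∣coeffs k 1≤k (ℕ.≤-trans k≤m m≤l)))

  p∣charPolyList-elemsℤ : ∀ {S : Subset p} {c} → c ∈ₛ S → + p ∣ evalDesc (charPolyList (elemsℤ S)) (toℤ c)
  p∣charPolyList-elemsℤ c∈S = subst (+ p ∣_) (sym (evalDesc-charPolyList-root (∈-map⁺ toℤ (∈-elems⁺ c∈S)))) p∣0

  subset-sumset-bound : ∀ {A B S : Subset p} {lA lB m N} → Nonempty A → Nonempty B → IsSumset pr A B S →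
    IsNull A lA → IsNull B lB → m ≤ lA → m ≤ lB →
    ∀ P → length P ≡ suc (N ℕ.+ m) → N < p → ¬ (+ p ∣ coeff P m) →
    (∀ {c} → c ∈ₛ S → + p ∣ evalDesc P (toℤ c)) →
    ∣ A ∣ ℕ.+ ∣ B ∣ ≤ suc N
  subset-sumset-bound {A} {B} {S} {N = N} (a , a∈A) (b , b∈B) A+B≡S nullA nullB m≤lA m≤lB P len-P N<p p∤Pm P≡0 =
    subst₂ (λ α β → α ℕ.+ β ≤ suc N) (length-elemsℤ A) (length-elemsℤ B)
      (sumset-degree-bound P (∈-map⁺ toℤ (∈-elems⁺ a∈A)) (∈-map⁺ toℤ (∈-elems⁺ b∈B))
        (distinct-elemsℤ A) (distinct-elemsℤ B) (null-coeffs {A} nullA m≤lA) (null-coeffs {B} nullB m≤lB)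
        len-P N<p p∤Pm P≡0-on-sums)
    where
    P≡0-on-sums : ∀ {x y} → x ∈ elemsℤ A → y ∈ elemsℤ B → + p ∣ evalDesc P (x + y)
    P≡0-on-sums x∈ y∈ with ∈-map⁻ toℤ x∈ | ∈-map⁻ toℤ y∈
    ... | a , a∈ , refl | b , b∈ , refl = p∣-cancel (p∣evalDesc-cong P (p∣⊕ a b)) (P≡0 a⊕b∈S)
      where
      a⊕b∈S = proj₂ (A+B≡S (a ⊕[ pr ] b)) (a , b , ∈-elems⁻ a∈ , ∈-elems⁻ b∈ , refl)

  -- With P = Π_S and m = λ(S) + 1, the coefficient of P at m does not vanish by maximality of λ(S).
  λ-gap-bound : ∀ {A B S : Subset p} {lA lB lS} → Nonempty A → Nonempty B → IsSumset pr A B S →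
    IsNull A lA → IsNull B lB → IsLambda S lS → lS < lA ⊓ lB → lS < ∣ S ∣ →
    ∣ A ∣ ℕ.+ ∣ B ∣ ℕ.+ lS ≤ ∣ S ∣
  λ-gap-bound {A} {B} {S} {lA} {lB} {lS} neA neB A+B≡S nullA nullB (nullS , maximal) lS<lA⊓lB lS<∣S∣ =
    ℕ.≤-trans (ℕ.+-monoˡ-≤ lS (subset-sumset-bound neA neB A+B≡S nullA nullB
                                (ℕ.m<n⊓o⇒m<n lA lB lS<lA⊓lB) (ℕ.m<n⊓o⇒m<o lA lB lS<lA⊓lB)
                                Π len-Π N<p p∤Πₘ p∣charPolyList-elemsℤ))
              (ℕ.≤-reflexive (trans (sym (ℕ.+-suc N lS)) N+m≡∣S∣))
    where
    N = ∣ S ∣ ∸ suc lS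
    Π = charPolyList (elemsℤ S)
    N+m≡∣S∣ : N ℕ.+ suc lS ≡ ∣ S ∣
    N+m≡∣S∣ = ℕ.m∸n+n≡m lS<∣S∣
    len-Π : length Π ≡ suc (N ℕ.+ suc lS)
    len-Π = trans (length-charPolyList (elemsℤ S)) (cong suc (trans (length-elemsℤ S) (sym N+m≡∣S∣)))
    N<p : N < p
    N<p = ℕ.<-≤-trans (ℕ.∸-monoʳ-< (s≤s z≤n) lS<∣S∣) (∣p∣≤n S)
    p∤Πₘ : ¬ (+ p ∣ coeff Π (suc lS))
    p∤Πₘ p∣Πₘ = ℕ.1+n≰n (maximal (suc lS) (lS<∣S∣ , null-to-suc))
      where
      null-to-suc : ∀ k → 1 ≤ k → k ≤ suc lS → (+ p) ∣ᵤ coeff (charPoly S) k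
      null-to-suc k 1≤k k≤1+lS with k ℕ.≤? lS
      ... | yes k≤lS = proj₂ nullS k 1≤k k≤lS
      ... | no  k≰lS rewrite ℕ.≤-antisym k≤1+lS (ℕ.≰⇒> k≰lS) | charPoly≡charPolyList S = ∣⇒∣ᵤ p∣Πₘ

  -- If λ(S) = |S|, then Π_S ≡ X^|S| and P = (X - 1) Π_S has m = 1 and N = |S|.
  λ-full-impossible : ∀ {A B S : Subset p} {lA lB lS} → Nonempty A → Nonempty B → IsSumset pr A B S →
    IsNull A lA → IsNull B lB → IsNull S lS → lS < lA ⊓ lB → lS ≢ ∣ S ∣
  λ-full-impossible {A} {B} {S} {lA} {lB} neA neB A+B≡S nullA nullB nullS lS<lA⊓lB refl =
    ℕ.<⇒≱ |A|+|B|>1+|S| (subset-sumset-bound neA neB A+B≡S nullA nullB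
      (ℕ.≤-trans (s≤s z≤n) lS<lA) (ℕ.≤-trans (s≤s z≤n) lS<lB) P len-P N<p p∤P₁ P≡0)
    where
    lS<lA = ℕ.m<n⊓o⇒m<n lA lB lS<lA⊓lB
    lS<lB = ℕ.m<n⊓o⇒m<o lA lB lS<lA⊓lB
    Π = charPolyList (elemsℤ S)
    P = mulXminus 1ℤ Π
    len-Π : length Π ≡ suc ∣ S ∣
    len-Π = trans (length-charPolyList (elemsℤ S)) (cong suc (length-elemsℤ S))
    len-P : length P ≡ suc (∣ S ∣ ℕ.+ 1)
    len-P = trans (length-mulXminus 1ℤ Π) (cong suc (trans len-Π (ℕ.+-comm 1 ∣ S ∣)))
    N<p : ∣ S ∣ < p
    N<p = ℕ.<-≤-trans lS<lA (ℕ.≤-trans (proj₁ nullA) (∣p∣≤n A))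
    p∣Π₁ : + p ∣ coeff Π 1
    p∣Π₁ with 1 ℕ.≤? ∣ S ∣
    ... | yes 1≤∣S∣ = null-coeffs {S} nullS 1≤∣S∣ 1 ℕ.≤-refl ℕ.≤-refl
    ... | no  1≰∣S∣ =
      subst (+ p ∣_) (sym (coeff-≥length Π 1 (ℕ.≤-trans (ℕ.≤-reflexive len-Π) (ℕ.≰⇒> 1≰∣S∣)))) p∣0
    p∤P₁ : ¬ (+ p ∣ coeff P 1)
    p∤P₁ p∣P₁ = ¬prime[1] (subst Prime (ℕ.∣1⇒≡1 (∣⇒∣ᵤ (∣m⇒∣-m (∣m+n∣m⇒∣n p∣Π₁-1 p∣Π₁)))) pr)
      where
      p∣Π₁-1 : + p ∣ coeff Π 1 - 1ℤ
      p∣Π₁-1 = subst (+ p ∣_) (trans (coeff₁-mulXminus 1ℤ Π) (cong (λ c → coeff Π 1 - c)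
                 (trans (ℤ.*-identityˡ _) (charPolyList-monic (elemsℤ S))))) p∣P₁
    P≡0 : ∀ {c} → c ∈ₛ S → + p ∣ evalDesc P (toℤ c)
    P≡0 {c} c∈S = subst (+ p ∣_) (sym (evalDesc-mulXminus 1ℤ Π (toℤ c)))
                    (∣n⇒∣m*n (toℤ c - 1ℤ) (p∣charPolyList-elemsℤ c∈S))
    |A|+|B|>1+|S| : suc ∣ S ∣ < ∣ A ∣ ℕ.+ ∣ B ∣
    |A|+|B|>1+|S| = subst (_≤ ∣ A ∣ ℕ.+ ∣ B ∣) (ℕ.+-comm (suc ∣ S ∣) 1)
      (ℕ.+-mono-≤ (ℕ.≤-trans lS<lA (proj₁ nullA)) (ℕ.≤-trans (s≤s z≤n) (ℕ.≤-trans lS<lB (proj₁ nullB))))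

theorem3p2 : (p : ℕ) → (pr : Prime p) → (A B S : Subset p) →
    Nonempty A → Nonempty B → IsSumset pr A B S →
    (lA lB lS : ℕ) → IsLambda A lA → IsLambda B lB → IsLambda S lS →
    (lA ⊓ lB ≤ lS) ⊎ (∣ A ∣ ℕ.+ ∣ B ∣ ℕ.+ lS ≤ ∣ S ∣)
theorem3p2 p pr A B S neA neB A+B≡S lA lB lS (nullA , _) (nullB , _) λS@(nullS , _) with lA ⊓ lB ℕ.≤? lS
... | yes ⊓≤lS = inj₁ ⊓≤lS
... | no  ⊓≰lS with lS ℕ.<? ∣ S ∣
...   | yes lS<∣S∣ = inj₂ (λ-gap-bound pr neA neB A+B≡S nullA nullB λS (ℕ.≰⇒> ⊓≰lS) lS<∣S∣)
...   | no  lS≮∣S∣ = ⊥-elim (λ-full-impossible pr neA neB A+B≡S nullA nullB nullS (ℕ.≰⇒> ⊓≰lS)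
                               (ℕ.≤-antisym (proj₁ nullS) (ℕ.≮⇒≥ lS≮∣S∣)))
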